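{- For all behaviours B, B1 and B2: if B [>>] B1 and B [>>] B2, then for every behaviour B' with B1 [V] B2 == B', we have B [>>] B'.
   Context: Behaviours of the process language SP are given by the grammar B ::= End | p!e @! a; B | p?x @? a; B | p(+)l @+ a; B | p & mB1 // mB2 | If e Then B1 Else B2 | Call X, with mB ::= None | Some (a,B) and labels l in {left, right}; in the branching term p & mB1 // mB2, mB1 is the (optional, annotated) behaviour offered for label left and mB2 the one for label right. The merge relation B1 [V] B2 == B (merge B1 B2 B) is defined inductively: End [V] End == End; Call X [V] Call X == Call X; two send terms (resp. receive, selection terms) with identical prefix merge to that prefix followed by the merge of their continuations; two conditionals with the same guard merge branchwise; two branching terms on the same process p merge label by label: if both offer a label (with the same annotation) the continuations are merged, if only one offers it that offer is kept, if neither offers it the result offers None. No other pairs are mergeable. The branching order B [>>] B' (more_branches) is defined inductively: End [>>] End; Call X [>>] Call X; congruence for send, receive and selection prefixes and for conditionals; and for branching terms p & mBl // mBr [>>] p & None // None, p & mBl // Some (a,Br) [>>] p & None // Some (a,Br') if Br [>>] Br', p & Some (a,Bl) // mBr [>>] p & Some (a,Bl') // None if Bl [>>] Bl', and p & Some (a,Bl) // Some (a',Br) [>>] p & Some (a,Bl') // Some (a',Br') if Bl [>>] Bl' and Br [>>] Br'. Intuitively, B [>>] B' means B offers at least the branches offered by B'. -}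

module Defs where

open import Data.Maybe using (Maybe; just; nothing)
open import Data.Product using (_×_; _,_)

data Label : Set where
  left right : Label

module SP (Pid Expr Var Ann RecVar : Set) where

  -- Behaviours of SP.  'branch p mBl mBr' is  p & mBl // mBr .
  data Behaviour : Set where
    End    : Behaviour
    Send   : Pid → Expr → Ann → Behaviour → Behaviour
    Recv   : Pid → Var → Ann → Behaviour → Behaviour
    Sel    : Pid → Label → Ann → Behaviour → Behaviour
    Branch : Pid → Maybe (Ann × Behaviour) → Maybe (Ann × Behaviour) → Behaviour
    If     : Expr → Behaviour → Behaviour → Behaviour
    Call   : RecVar → Behaviour

  mutual
    data mergeM : Maybe (Ann × Behaviour) → Maybe (Ann × Behaviour) → Maybe (Ann × Behaviour) → Set where
      mm-none  : mergeM nothing nothing nothing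
      mm-left  : ∀ {a B} → mergeM (just (a , B)) nothing (just (a , B))
      mm-right : ∀ {a B} → mergeM nothing (just (a , B)) (just (a , B))
      mm-both  : ∀ {a B1 B2 B} → merge B1 B2 B → mergeM (just (a , B1)) (just (a , B2)) (just (a , B))

    data merge : Behaviour → Behaviour → Behaviour → Set where
      m-end    : merge End End End
      m-call   : ∀ {X} → merge (Call X) (Call X) (Call X)
      m-send   : ∀ {p e a B1 B2 B} → merge B1 B2 B → merge (Send p e a B1) (Send p e a B2) (Send p e a B)
      m-recv   : ∀ {p x a B1 B2 B} → merge B1 B2 B → merge (Recv p x a B1) (Recv p x a B2) (Recv p x a B)
      m-sel    : ∀ {p l a B1 B2 B} → merge B1 B2 B → merge (Sel p l a B1) (Sel p l a B2) (Sel p l a B)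
      m-if     : ∀ {e B1 B2 B1' B2' B B'} → merge B1 B1' B → merge B2 B2' B' →
                 merge (If e B1 B2) (If e B1' B2') (If e B B')
      m-branch : ∀ {p l1 r1 l2 r2 l r} → mergeM l1 l2 l → mergeM r1 r2 r →
                 merge (Branch p l1 r1) (Branch p l2 r2) (Branch p l r)

  data more-branches : Behaviour → Behaviour → Set where
    mb-end  : more-branches End End
    mb-call : ∀ {X} → more-branches (Call X) (Call X)
    mb-send : ∀ {p e a B B'} → more-branches B B' → more-branches (Send p e a B) (Send p e a B')
    mb-recv : ∀ {p x a B B'} → more-branches B B' → more-branches (Recv p x a B) (Recv p x a B')
    mb-sel  : ∀ {p l a B B'} → more-branches B B' → more-branches (Sel p l a B) (Sel p l a B')
    mb-if   : ∀ {e B1 B2 B1' B2'} → more-branches B1 B1' → more-branches B2 B2' →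
              more-branches (If e B1 B2) (If e B1' B2')
    mb-none  : ∀ {p mBl mBr} → more-branches (Branch p mBl mBr) (Branch p nothing nothing)
    mb-right : ∀ {p mBl a Br Br'} → more-branches Br Br' →
               more-branches (Branch p mBl (just (a , Br))) (Branch p nothing (just (a , Br')))
    mb-left  : ∀ {p a Bl Bl' mBr} → more-branches Bl Bl' →
               more-branches (Branch p (just (a , Bl)) mBr) (Branch p (just (a , Bl')) nothing)
    mb-both  : ∀ {p a a' Bl Bl' Br Br'} → more-branches Bl Bl' → more-branches Br Br' →
               more-branches (Branch p (just (a , Bl)) (just (a' , Br))) (Branch p (just (a , Bl')) (just (a' , Br')))

module Submission where

open import Defs
open import Data.Maybe using (Maybe; just; nothing)
open import Data.Product using (_×_; _,_)
open import Relation.Binary.PropositionalEquality using (_≡_; refl)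

-- On branching terms [>>] is label-wise: each label of the smaller term is either
-- dropped or kept with a continuation that the larger one dominates.  A merge only
-- unions the offers of its arguments label by label, so an upper bound of both
-- arguments bounds the merge, by mutual induction on the merge derivation.

module MoreBranches (Pid Expr Var Ann RecVar : Set) where
  open SP Pid Expr Var Ann RecVar

  Offer : Set
  Offer = Maybe (Ann × Behaviour)

  data more-offers : Offer → Offer → Set where
    offer-dropped : ∀ {mB} → more-offers mB nothing
    offer-kept    : ∀ {a B B'} → more-branches B B' → more-offers (just (a , B)) (just (a , B'))

  more-branches-Branch⁻ : ∀ {p q L R l r} → more-branches (Branch p L R) (Branch q l r) →
                          p ≡ q × more-offers L l × more-offers R r
  more-branches-Branch⁻ mb-none       = refl , offer-dropped , offer-dropped
  more-branches-Branch⁻ (mb-right h)  = refl , offer-dropped , offer-kept h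
  more-branches-Branch⁻ (mb-left h)   = refl , offer-kept h  , offer-dropped
  more-branches-Branch⁻ (mb-both h k) = refl , offer-kept h  , offer-kept k

  more-branches-Branch⁺ : ∀ {p L R l r} → more-offers L l → more-offers R r →
                          more-branches (Branch p L R) (Branch p l r)
  more-branches-Branch⁺ offer-dropped  offer-dropped  = mb-none
  more-branches-Branch⁺ offer-dropped  (offer-kept k) = mb-right k
  more-branches-Branch⁺ (offer-kept h) offer-dropped  = mb-left h
  more-branches-Branch⁺ (offer-kept h) (offer-kept k) = mb-both h k

  mutual
    more-branches-merge : ∀ {B B1 B2 B'} → more-branches B B1 → more-branches B B2 →
                          merge B1 B2 B' → more-branches B B'
    more-branches-merge mb-end      mb-end      m-end        = mb-end
    more-branches-merge mb-call     mb-call     m-call       = mb-call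
    more-branches-merge (mb-send h) (mb-send k) (m-send m)   = mb-send (more-branches-merge h k m)
    more-branches-merge (mb-recv h) (mb-recv k) (m-recv m)   = mb-recv (more-branches-merge h k m)
    more-branches-merge (mb-sel h)  (mb-sel k)  (m-sel m)    = mb-sel (more-branches-merge h k m)
    more-branches-merge (mb-if h h') (mb-if k k') (m-if m m') =
      mb-if (more-branches-merge h k m) (more-branches-merge h' k' m')
    more-branches-merge {Branch _ _ _} h k (m-branch ml mr)
      with more-branches-Branch⁻ h | more-branches-Branch⁻ k
    ... | refl , hl , hr | refl , kl , kr =
      more-branches-Branch⁺ (more-offers-mergeM hl kl ml) (more-offers-mergeM hr kr mr)

    more-offers-mergeM : ∀ {L l1 l2 l} → more-offers L l1 → more-offers L l2 →
                         mergeM l1 l2 l → more-offers L l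
    more-offers-mergeM offer-dropped  offer-dropped  mm-none     = offer-dropped
    more-offers-mergeM h              offer-dropped  mm-left     = h
    more-offers-mergeM offer-dropped  k              mm-right    = k
    more-offers-mergeM (offer-kept h) (offer-kept k) (mm-both m) = offer-kept (more-branches-merge h k m)

mainTheorem14 : (Pid Expr Var Ann RecVar : Set) →
    let open SP Pid Expr Var Ann RecVar in
    ∀ (B B1 B2 : Behaviour) → more-branches B B1 → more-branches B B2 →
    ∀ (B' : Behaviour) → merge B1 B2 B' → more-branches B B'
mainTheorem14 Pid Expr Var Ann RecVar _ _ _ h k _ m =
  MoreBranches.more-branches-merge Pid Expr Var Ann RecVar h k m
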